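{- Let $G\in\mathcal{C}$ be connected and let $o$ be an extremal orientation of $G$. Then there is no vertex subset $S\subseteq V(G)$ whose vertices together dominate at least $|S|+2$ vertices, i.e. there is no $S$ with $\left|\bigcup_{v\in S}N^o_+(v)\right|\ge |S|+2$.
   Context: All graphs are finite and simple. $\mathcal{C}$ is the class of graphs in which every connected component contains a cycle. An orientation $o$ of $G$ is valid if every vertex has in-degree at least $1$. For a directed graph, a total dominating set is a set $S$ such that every vertex has an in-neighbor in $S$, and $\gamma_t$ is the minimum size of such a set. A valid orientation $o$ of a connected graph $G\in\mathcal{C}$ is extremal if its total domination number equals $|V(G)|-1$. $N^o_+(v)$ denotes the out-neighborhood of $v$ in $o$. -}

module Defs where

open import Data.Nat using (ℕ; _≤_; _+_; _∸_; suc)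
open import Data.Bool using (Bool; true; false; T)
open import Data.Fin using (Fin)
open import Data.Fin.Subset using (Subset; _∈_; ∣_∣)
open import Data.Fin.Subset.Properties using (_∈?_)
open import Data.Fin.Properties using (any?)
open import Data.Vec using (tabulate)
open import Data.List using (List; []; _∷_; length)
open import Data.List.Relation.Unary.Unique.Propositional using (Unique)
open import Data.Product using (Σ; ∃; _×_; _,_)
open import Data.Sum using (_⊎_)
open import Relation.Nullary using (¬_)
open import Relation.Nullary.Decidable using (⌊_⌋; _×-dec_)
open import Relation.Binary.PropositionalEquality using (_≡_)
open import Data.Bool using (_≟_)

record Graph (n : ℕ) : Set where
  field
    adj   : Fin n → Fin n → Bool
    sym   : ∀ u v → adj u v ≡ adj v u
    irref : ∀ v → adj v v ≡ false
open Graph public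

Adj : ∀ {n} → Graph n → Fin n → Fin n → Set
Adj G u v = adj G u v ≡ true

data Walk {n} (G : Graph n) : Fin n → Fin n → Set where
  here : ∀ v → Walk G v v
  step : ∀ {u w v} → Adj G u w → Walk G w v → Walk G u v

Connected : ∀ {n} → Graph n → Set
Connected G = ∀ u v → Walk G u v

PathFrom : ∀ {n} → Graph n → Fin n → List (Fin n) → Fin n → Set
PathFrom G x [] y = x ≡ y
PathFrom G x (z ∷ zs) y = Adj G x z × PathFrom G z zs y

-- A cycle: distinct vertices x ∷ xs (at least 3 of them), consecutive ones
-- adjacent, and the last adjacent to the first x.
HasCycle : ∀ {n} → Graph n → Set
HasCycle {n} G =
  Σ (Fin n) λ x → Σ (List (Fin n)) λ xs → Σ (Fin n) λ y →
    Unique (x ∷ xs) × (2 ≤ length xs) × PathFrom G x xs y × Adj G y x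

-- An orientation: for each edge exactly one direction is chosen;
-- arcs only along edges.  arc u v = true means u → v.
record Orientation {n} (G : Graph n) : Set where
  field
    arc      : Fin n → Fin n → Bool
    arc-edge : ∀ u v → arc u v ≡ true → Adj G u v
    edge-arc : ∀ u v → Adj G u v → (arc u v ≡ true) ⊎ (arc v u ≡ true)
    antisym  : ∀ u v → arc u v ≡ true → arc v u ≡ false
open Orientation public

Arc : ∀ {n} {G : Graph n} → Orientation G → Fin n → Fin n → Set
Arc o u v = arc o u v ≡ true

Valid : ∀ {n} {G : Graph n} → Orientation G → Set
Valid {n} o = ∀ v → ∃ λ (u : Fin n) → Arc o u v

IsTDS : ∀ {n} {G : Graph n} → Orientation G → Subset n → Set
IsTDS {n} o S = ∀ v → ∃ λ (u : Fin n) → u ∈ S × Arc o u v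

TotalDomNumber : ∀ {n} {G : Graph n} → Orientation G → ℕ → Set
TotalDomNumber {n} o k =
  (Σ (Subset n) λ S → IsTDS o S × ∣ S ∣ ≡ k) × (∀ S → IsTDS o S → k ≤ ∣ S ∣)

Extremal : ∀ {n} {G : Graph n} → Orientation G → Set
Extremal {n} o = Valid o × TotalDomNumber o (n ∸ 1)

OutUnion : ∀ {n} {G : Graph n} → Orientation G → Subset n → Subset n
OutUnion o S = tabulate λ v → ⌊ any? (λ u → (u ∈? S) ×-dec (arc o u v ≟ true)) ⌋

{-# OPTIONS --safe #-}
module Submission where

-- Extremality is all that is used.  For any S, every vertex outside
-- N⁺(S) = ⋃_{u ∈ S} N⁺(u) has some in-neighbour by validity, so S together
-- with one chosen in-neighbour of each vertex outside N⁺(S) is a total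
-- dominating set of size at most |S| + (n − |N⁺(S)|).  If |N⁺(S)| ≥ |S| + 2
-- this is at most n − 2, contradicting γₜ = n − 1.

open import Defs
open import Data.Nat using (ℕ; _+_; _≥_; _≤_; _∸_; suc; z≤n; s≤s)
open import Data.Nat.Properties
  using (≤-refl; ≤-trans; ≤-reflexive; n≤1+n; +-suc; +-comm; +-assoc; +-mono-≤; +-monoʳ-≤;
         +-cancelˡ-≤; m∸n+n≡m; m≤n+m∸n; 1+n≰n; module ≤-Reasoning)
open import Data.Fin using (Fin) renaming (zero to fzero; suc to fsuc)
open import Data.Fin.Subset using (Subset; ∣_∣; _∈_; _∪_; ∁; ⁅_⁆; ⊥; inside; outside)
open import Data.Fin.Subset.Properties
  using (p⊆p∪q; q⊆p∪q; x∈⁅x⁆; ∣⁅x⁆∣≡1; ∣⊥∣≡0; x∉p⇒x∈∁p; ∣∁p∣≡n∸∣p∣; ∣p∣≤n; _∈?_)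
open import Data.Bool.Properties using (T-≡)
open import Data.Vec using ([]; _∷_; here; there)
open import Data.Vec.Properties using (lookup∘tabulate; []=⇒lookup)
open import Data.Product using (Σ; ∃; _×_; _,_; proj₁; proj₂)
open import Function using (_∘_; Equivalence)
open import Relation.Nullary using (¬_; yes; no)
open import Relation.Nullary.Decidable using (toWitness)
open import Relation.Binary.PropositionalEquality as ≡ using (_≡_; trans; cong)

∣p∪q∣≤∣p∣+∣q∣ : ∀ {n} (p q : Subset n) → ∣ p ∪ q ∣ ≤ ∣ p ∣ + ∣ q ∣
∣p∪q∣≤∣p∣+∣q∣ []            []            = z≤n
∣p∪q∣≤∣p∣+∣q∣ (inside  ∷ p) (inside  ∷ q) = s≤s (≤-trans (∣p∪q∣≤∣p∣+∣q∣ p q) (+-monoʳ-≤ ∣ p ∣ (n≤1+n ∣ q ∣)))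
∣p∪q∣≤∣p∣+∣q∣ (inside  ∷ p) (outside ∷ q) = s≤s (∣p∪q∣≤∣p∣+∣q∣ p q)
∣p∪q∣≤∣p∣+∣q∣ (outside ∷ p) (inside  ∷ q) rewrite +-suc ∣ p ∣ ∣ q ∣ = s≤s (∣p∪q∣≤∣p∣+∣q∣ p q)
∣p∪q∣≤∣p∣+∣q∣ (outside ∷ p) (outside ∷ q) = ∣p∪q∣≤∣p∣+∣q∣ p q

∣∁p∣+∣p∣≡n : ∀ {n} (p : Subset n) → ∣ ∁ p ∣ + ∣ p ∣ ≡ n
∣∁p∣+∣p∣≡n p = trans (cong (_+ ∣ p ∣) (∣∁p∣≡n∸∣p∣ p)) (m∸n+n≡m (∣p∣≤n p))

image : ∀ {m n} → (Fin m → Fin n) → Subset m → Subset n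
image f []            = ⊥
image f (inside  ∷ p) = ⁅ f fzero ⁆ ∪ image (f ∘ fsuc) p
image f (outside ∷ p) = image (f ∘ fsuc) p

∣image∣≤∣p∣ : ∀ {m n} (f : Fin m → Fin n) (p : Subset m) → ∣ image f p ∣ ≤ ∣ p ∣
∣image∣≤∣p∣ {n = n} f [] = ≤-reflexive (∣⊥∣≡0 n)
∣image∣≤∣p∣ f (inside ∷ p) = begin
  ∣ ⁅ f fzero ⁆ ∪ image (f ∘ fsuc) p ∣    ≤⟨ ∣p∪q∣≤∣p∣+∣q∣ ⁅ f fzero ⁆ (image (f ∘ fsuc) p) ⟩
  ∣ ⁅ f fzero ⁆ ∣ + ∣ image (f ∘ fsuc) p ∣ ≡⟨ cong (_+ ∣ image (f ∘ fsuc) p ∣) (∣⁅x⁆∣≡1 (f fzero)) ⟩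
  suc ∣ image (f ∘ fsuc) p ∣               ≤⟨ s≤s (∣image∣≤∣p∣ (f ∘ fsuc) p) ⟩
  suc ∣ p ∣                                ∎
  where open ≤-Reasoning
∣image∣≤∣p∣ f (outside ∷ p) = ∣image∣≤∣p∣ (f ∘ fsuc) p

x∈p⇒f[x]∈image : ∀ {m n} (f : Fin m → Fin n) {p : Subset m} {x} → x ∈ p → f x ∈ image f p
x∈p⇒f[x]∈image f {inside  ∷ p} here       = p⊆p∪q (image (f ∘ fsuc) p) (x∈⁅x⁆ (f fzero))
x∈p⇒f[x]∈image f {inside  ∷ p} (there x∈p) = q⊆p∪q ⁅ f fzero ⁆ _ (x∈p⇒f[x]∈image (f ∘ fsuc) x∈p)
x∈p⇒f[x]∈image f {outside ∷ p} (there x∈p) = x∈p⇒f[x]∈image (f ∘ fsuc) x∈p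

module _ {n} {G : Graph n} (o : Orientation G) where

  ∈OutUnion⇒∃inNeighbour : ∀ S {v} → v ∈ OutUnion o S → ∃ λ u → u ∈ S × Arc o u v
  ∈OutUnion⇒∃inNeighbour S {v} v∈N⁺S =
    toWitness (Equivalence.from T-≡ (trans (≡.sym (lookup∘tabulate _ v)) ([]=⇒lookup v∈N⁺S)))

  module _ (valid : Valid o) (S : Subset n) where

    completion : Subset n
    completion = S ∪ image (proj₁ ∘ valid) (∁ (OutUnion o S))

    completion-isTDS : IsTDS o completion
    completion-isTDS v with v ∈? OutUnion o S
    ... | yes v∈N⁺S = let (u , u∈S , u→v) = ∈OutUnion⇒∃inNeighbour S v∈N⁺S
                      in u , p⊆p∪q _ u∈S , u→v
    ... | no  v∉N⁺S = proj₁ (valid v)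
                    , q⊆p∪q S _ (x∈p⇒f[x]∈image (proj₁ ∘ valid) (x∉p⇒x∈∁p v∉N⁺S))
                    , proj₂ (valid v)

    ∣completion∣+∣OutUnion∣≤∣S∣+n : ∣ completion ∣ + ∣ OutUnion o S ∣ ≤ ∣ S ∣ + n
    ∣completion∣+∣OutUnion∣≤∣S∣+n = begin
      ∣ completion ∣ + ∣ N⁺S ∣                ≤⟨ +-mono-≤ (∣p∪q∣≤∣p∣+∣q∣ S chosen) ≤-refl ⟩
      ∣ S ∣ + ∣ chosen ∣ + ∣ N⁺S ∣            ≤⟨ +-mono-≤ (+-monoʳ-≤ ∣ S ∣ (∣image∣≤∣p∣ (proj₁ ∘ valid) undominated)) ≤-refl ⟩
      ∣ S ∣ + ∣ undominated ∣ + ∣ N⁺S ∣       ≡⟨ +-assoc ∣ S ∣ _ _ ⟩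
      ∣ S ∣ + (∣ undominated ∣ + ∣ N⁺S ∣)     ≡⟨ cong (∣ S ∣ +_) (∣∁p∣+∣p∣≡n N⁺S) ⟩
      ∣ S ∣ + n                                ∎
      where
      open ≤-Reasoning
      N⁺S = OutUnion o S
      undominated = ∁ N⁺S
      chosen = image (proj₁ ∘ valid) undominated

mainTheorem3 : (n : ℕ) (G : Graph n) → Connected G → HasCycle G →
    (o : Orientation G) → Extremal o →
    ¬ (Σ (Subset n) λ S → ∣ OutUnion o S ∣ ≥ ∣ S ∣ + 2)
mainTheorem3 n G _ _ o (valid , _ , γₜ-minimal) (S , ∣S∣+2≤∣N⁺S∣) = 1+n≰n (+-cancelˡ-≤ ∣ S ∣ _ _ (begin
  ∣ S ∣ + suc n                    ≤⟨ +-monoʳ-≤ ∣ S ∣ (s≤s (m≤n+m∸n n 1)) ⟩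
  ∣ S ∣ + (2 + (n ∸ 1))            ≡⟨ +-assoc ∣ S ∣ 2 (n ∸ 1) ⟨
  ∣ S ∣ + 2 + (n ∸ 1)              ≤⟨ +-mono-≤ ∣S∣+2≤∣N⁺S∣ (γₜ-minimal T (completion-isTDS o valid S)) ⟩
  ∣ OutUnion o S ∣ + ∣ T ∣         ≡⟨ +-comm (∣ OutUnion o S ∣) (∣ T ∣) ⟩
  ∣ T ∣ + ∣ OutUnion o S ∣         ≤⟨ ∣completion∣+∣OutUnion∣≤∣S∣+n o valid S ⟩
  ∣ S ∣ + n                        ∎))
  where
  open ≤-Reasoning
  T = completion o valid S
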